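{- For any set $S = \{x_1, x_2, \ldots, x_{n}\}$ of $n \le n_{\max}$ keys, with probability at least $1 - 1/\mathrm{poly}(n_{\max})$, $h(x_1), \ldots, h(x_n)$ are pairwise distinct.
   Context: Let $W = \mathrm{poly}(n_{\max})$ be a sufficiently large power of two, where $n_{\max}$ is an upper bound on the number of keys. Every key $x\in[U]$ is written as $x = x_{\mathrm{high}}\cdot W^4 + x_{\mathrm{mid}}\cdot W + x_{\mathrm{low}}$, where $x_{\mathrm{low}}\in[W]$ and $x_{\mathrm{mid}}\in[W^3]$; let $x_{\mathrm{midlow}} = x_{\mathrm{mid}}\cdot W + x_{\mathrm{low}}\in[W^4]$. There are $\mathrm{poly}(W)$ independent auxiliary arrays $A_1,\ldots,A_{\mathrm{poly}(W)}$ of length $W^4$, each a concatenation of $W^3$ independent uniformly random permutations of $[W]$, and a pairwise-independent hash function $f:[U/W^4]\to[\mathrm{poly}(W)]$. The weight function is $h(x) = A_{f(x_{\mathrm{high}})}[x_{\mathrm{midlow}}]$. Probability is over the random choice of the arrays and $f$. -}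

module Defs where

open import Data.Nat using (ℕ; zero; suc; _*_; _^_)
open import Data.Bool using (Bool; _∧_; not)
open import Data.Fin using (Fin; remQuot; _≟_)
open import Data.Fin.Properties using ()
open import Data.Product using (_×_; _,_; proj₁; proj₂; ∃)
open import Data.Vec using (Vec; []; _∷_; lookup; toList)
open import Data.List using (List; []; _∷_; [_]; concatMap; map; length; filterᵇ; allFin; cartesianProduct)
open import Data.Bool.ListAction using (any)
open import Data.List.Relation.Unary.Unique.DecPropositional using (unique?)
open import Relation.Nullary using (does)
open import Relation.Binary.PropositionalEquality using (_≡_; _≢_)

allVecs : {A : Set} → List A → (n : ℕ) → List (Vec A n)
allVecs xs zero    = [ [] ]
allVecs xs (suc n) = concatMap (λ x → map (x ∷_) (allVecs xs n)) xs

-- a permutation of [W], given as the vector of its values (all distinct)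
Perm : ℕ → Set
Perm W = Vec (Fin W) W

allPerms : (W : ℕ) → List (Perm W)
allPerms W = filterᵇ (λ v → does (unique? _≟_ (toList v))) (allVecs (allFin W) W)

-- one auxiliary array of length W^4 = concatenation of W^3 permutations of [W]
Array : ℕ → Set
Array W = Vec (Perm W) (W ^ 3)

Arrays : ℕ → ℕ → Set
Arrays W P = Vec (Array W) P

-- sample space of the arrays: all choices, each equally likely
allArrays : (W P : ℕ) → List (Arrays W P)
allArrays W P = allVecs (allVecs (allPerms W) (W ^ 3)) P

-- keys of the universe [U] with U = M * W^4 (W^4 written as W^3 * W)
Key : ℕ → ℕ → Set
Key M W = Fin (M * (W ^ 3 * W))

high : {M W : ℕ} → Key M W → Fin M
high {M} {W} x = proj₁ (remQuot {M} (W ^ 3 * W) x)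

midlow : {M W : ℕ} → Key M W → Fin (W ^ 3 * W)
midlow {M} {W} x = proj₂ (remQuot {M} (W ^ 3 * W) x)

mid : {M W : ℕ} → Key M W → Fin (W ^ 3)
mid {M} {W} x = proj₁ (remQuot {W ^ 3} W (midlow {M} {W} x))

low : {M W : ℕ} → Key M W → Fin W
low {M} {W} x = proj₂ (remQuot {W ^ 3} W (midlow {M} {W} x))

-- A[x_midlow] : entry x_low of the x_mid-th permutation block of A
arrayAt : {W : ℕ} → Array W → Fin (W ^ 3) → Fin W → Fin W
arrayAt A i j = lookup (lookup A i) j

hashH : {M W P : ℕ} → (Fin M → Fin P) → Arrays W P → Key M W → Fin W
hashH {M} {W} f A x = arrayAt (lookup A (f (high {M} {W} x))) (mid {M} {W} x) (low {M} {W} x)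

count : {A : Set} → (A → Bool) → List A → ℕ
count p xs = length (filterᵇ p xs)

-- a hash family (multiset of K functions [M] → [P], drawn uniformly) is
-- pairwise independent: for a ≠ b and any targets i, j,
-- Pr_k[F k a = i ∧ F k b = j] = 1 / P^2
PairwiseIndependent : {K M P : ℕ} → (Fin K → Fin M → Fin P) → Set
PairwiseIndependent {K} {M} {P} F =
  (a b : Fin M) → a ≢ b → (i j : Fin P) →
  count (λ k → does (F k a ≟ i) ∧ does (F k b ≟ j)) (allFin K) * (P * P) ≡ K

hasCollision : {n W : ℕ} → (Fin n → Fin W) → Bool
hasCollision {n} g =
  any (λ ij → not (does (proj₁ ij ≟ proj₂ ij)) ∧ does (g (proj₁ ij) ≟ g (proj₂ ij)))
      (cartesianProduct (allFin n) (allFin n))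

-- number of outcomes (k, A) of the random choices (f = F k, arrays A) for which
-- h(x_1), ..., h(x_n) are not pairwise distinct; total number of outcomes is K * |allArrays|
badCount : {K M : ℕ} (W : ℕ) {P n : ℕ} → (Fin K → Fin M → Fin P) → (Fin n → Key M W) → ℕ
badCount {K} {M} W {P} F xs =
  count (λ kA → hasCollision (λ i → hashH (F (proj₁ kA)) (proj₂ kA) (xs i)))
        (cartesianProduct (allFin K) (allArrays W P))

totalCount : (K W P : ℕ) → ℕ
totalCount K W P = K * length (allArrays W P)

PowerOfTwo : ℕ → Set
PowerOfTwo W = ∃ λ e → W ≡ 2 ^ e

-- For fixed distinct keys x ≠ y and a fixed choice of f, h(x) and h(y) are the entries of the
-- arrays at the positions (f(x_high), x_mid, x_low) and (f(y_high), y_mid, y_low).  If these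
-- positions differ, the entries collide with probability at most 1/W: entries of different arrays
-- or of different permutation blocks are independent and each is uniform on [W], while two entries
-- of the same permutation never coincide.  The positions coincide only when x_high ≠ y_high but
-- f(x_high) = f(y_high), which by pairwise independence has probability 1/P ≤ 1/W.  Hence
-- Pr[h(x) = h(y)] ≤ 2/W, and a union bound over the n² ordered pairs bounds the failure
-- probability by 2n²/W ≤ 1/n_max^c as soon as W ≥ n_max^(c+3).
module Submission where

open import Data.Bool using (Bool; true; false; _∧_; _∨_; not)
open import Data.Bool.ListAction using (any)
open import Data.Fin using (Fin; _≟_; combine) renaming (zero to fzero; suc to fsuc)
open import Data.Fin.Permutation using (Permutation; _⟨$⟩ʳ_; _⟨$⟩ˡ_; inverseˡ; inverseʳ; transpose)
open import Data.Fin.Properties using (combine-remQuot)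
open import Data.List using (List; []; _∷_; _++_; map; length; concatMap; tabulate; allFin; filterᵇ; cartesianProduct; cartesianProductWith)
open import Data.List.Properties using (length-++; length-map; length-tabulate; length-filter)
open import Data.List.Relation.Unary.All using (All; _∷_)
open import Data.List.Relation.Unary.AllPairs using (_∷_)
open import Data.List.Relation.Unary.Unique.DecPropositional using (unique?)
open import Data.List.Relation.Unary.Unique.Propositional using (Unique)
import Data.List.Relation.Unary.Unique.Propositional.Properties as Unique
open import Data.Nat using (ℕ; zero; suc; _≤_; _*_; _^_; _+_; z≤n; s≤s)
open import Data.Nat.Properties
  using (≤-refl; ≤-reflexive; ≤-trans; +-mono-≤; +-monoʳ-≤; *-monoˡ-≤; *-monoʳ-≤; *-mono-≤; ^-monoˡ-≤;
         +-assoc; *-assoc; *-comm; *-identityˡ; *-identityʳ; *-zeroʳ; +-identityʳ; *-distribʳ-+; ^-zeroˡ;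
         m≤m+n; m≤n+m; n≤0⇒n≡0; *-cancelʳ-≤; *-cancelˡ-≤; +-*-semiring; +-commutativeSemigroup; module ≤-Reasoning)
open import Data.Nat.Tactic.RingSolver using (solve-∀)
open import Algebra.Properties.CommutativeSemigroup +-commutativeSemigroup using (interchange)
open import Algebra.Properties.Semiring.Sum +-*-semiring using (sum-syntax; sum-cong-≗; ∑-distrib-+; ∑-permute; *-distribʳ-sum)
open import Data.Product using (∃; _×_; _,_; proj₁; proj₂)
open import Data.Product.Properties using (≡-dec)
open import Data.Vec using (Vec; lookup; toList) renaming ([] to []ᵥ; _∷_ to _∷ᵥ_; map to mapᵥ)
open import Data.Vec.Properties using (toList-map; lookup-map)
open import Function using (_∘_; _$_; id)
open import Function.Bundles using (Injection; _⇔_; mk⇔)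
open import Function.Definitions using (Injective)
open import Function.Properties.Inverse using (↔⇒↣)
open import Relation.Binary.Definitions using (DecidableEquality)
open import Relation.Binary.PropositionalEquality using (_≡_; refl; sym; trans; cong; cong₂; subst)
open import Relation.Nullary using (Dec; does; yes; no; ¬_; contradiction)
open import Relation.Nullary.Decidable using (T?; does-⇔; dec-true; dec-false)

open import Defs

open ≤-Reasoning

variable
  A B C : Set

𝟙 : Bool → ℕ
𝟙 true  = 1
𝟙 false = 0

𝟙-∨ : ∀ a b → 𝟙 (a ∨ b) ≤ 𝟙 a + 𝟙 b
𝟙-∨ true  b = s≤s z≤n
𝟙-∨ false b = ≤-refl

𝟙-does-mono : {P Q : Set} → (P → Q) → (p? : Dec P) (q? : Dec Q) → 𝟙 (does p?) ≤ 𝟙 (does q?)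
𝟙-does-mono P⇒Q (yes p) (yes q) = ≤-refl
𝟙-does-mono P⇒Q (yes p) (no ¬q) = contradiction (P⇒Q p) ¬q
𝟙-does-mono P⇒Q (no ¬p) q?      = z≤n

count-cons : (p : A → Bool) (x : A) (xs : List A) → count p (x ∷ xs) ≡ 𝟙 (p x) + count p xs
count-cons p x xs with p x
... | true  = refl
... | false = refl

count-++ : (p : A → Bool) (xs ys : List A) → count p (xs ++ ys) ≡ count p xs + count p ys
count-++ p []       ys = refl
count-++ p (x ∷ xs) ys = begin-equality
  count p (x ∷ xs ++ ys)               ≡⟨ count-cons p x (xs ++ ys) ⟩
  𝟙 (p x) + count p (xs ++ ys)         ≡⟨ cong (𝟙 (p x) +_) (count-++ p xs ys) ⟩
  𝟙 (p x) + (count p xs + count p ys)  ≡⟨ +-assoc (𝟙 (p x)) _ _ ⟨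
  𝟙 (p x) + count p xs + count p ys    ≡⟨ cong (_+ count p ys) (count-cons p x xs) ⟨
  count p (x ∷ xs) + count p ys        ∎

count-map : (p : B → Bool) (f : A → B) (xs : List A) → count p (map f xs) ≡ count (p ∘ f) xs
count-map p f []       = refl
count-map p f (x ∷ xs) = begin-equality
  count p (f x ∷ map f xs)          ≡⟨ count-cons p (f x) (map f xs) ⟩
  𝟙 (p (f x)) + count p (map f xs)  ≡⟨ cong (𝟙 (p (f x)) +_) (count-map p f xs) ⟩
  𝟙 (p (f x)) + count (p ∘ f) xs    ≡⟨ count-cons (p ∘ f) x xs ⟨
  count (p ∘ f) (x ∷ xs)            ∎

count-cong : {p q : A → Bool} → (∀ x → p x ≡ q x) → (xs : List A) → count p xs ≡ count q xs
count-cong {p = p} {q} p≗q []       = refl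
count-cong {p = p} {q} p≗q (x ∷ xs) = begin-equality
  count p (x ∷ xs)      ≡⟨ count-cons p x xs ⟩
  𝟙 (p x) + count p xs  ≡⟨ cong₂ _+_ (cong 𝟙 (p≗q x)) (count-cong p≗q xs) ⟩
  𝟙 (q x) + count q xs  ≡⟨ count-cons q x xs ⟨
  count q (x ∷ xs)      ∎

count-const : (b : Bool) (xs : List A) → count (λ _ → b) xs ≡ 𝟙 b * length xs
count-const false []       = refl
count-const false (x ∷ xs) = count-const false xs
count-const true  []       = refl
count-const true  (x ∷ xs) = cong suc (count-const true xs)

count-≤-length : (p : A → Bool) (xs : List A) → count p xs ≤ length xs
count-≤-length p = length-filter (T? ∘ p)

count-mono : {p q : A → Bool} → (∀ x → 𝟙 (p x) ≤ 𝟙 (q x)) → (xs : List A) → count p xs ≤ count q xs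
count-mono {p = p} {q} p⇒q []       = z≤n
count-mono {p = p} {q} p⇒q (x ∷ xs) = begin
  count p (x ∷ xs)      ≡⟨ count-cons p x xs ⟩
  𝟙 (p x) + count p xs  ≤⟨ +-mono-≤ (p⇒q x) (count-mono p⇒q xs) ⟩
  𝟙 (q x) + count q xs  ≡⟨ count-cons q x xs ⟨
  count q (x ∷ xs)      ∎

count-∨ : (p q : A → Bool) (xs : List A) → count (λ x → p x ∨ q x) xs ≤ count p xs + count q xs
count-∨ p q []       = z≤n
count-∨ p q (x ∷ xs) = begin
  count (λ x → p x ∨ q x) (x ∷ xs)                 ≡⟨ count-cons (λ x → p x ∨ q x) x xs ⟩
  𝟙 (p x ∨ q x) + count (λ x → p x ∨ q x) xs       ≤⟨ +-mono-≤ (𝟙-∨ (p x) (q x)) (count-∨ p q xs) ⟩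
  (𝟙 (p x) + 𝟙 (q x)) + (count p xs + count q xs)  ≡⟨ interchange (𝟙 (p x)) (𝟙 (q x)) (count p xs) (count q xs) ⟩
  (𝟙 (p x) + count p xs) + (𝟙 (q x) + count q xs)  ≡⟨ cong₂ _+_ (count-cons p x xs) (count-cons q x xs) ⟨
  count p (x ∷ xs) + count q (x ∷ xs)              ∎

-- Pr[x ← xs] (p x) ≤ N / D, for x drawn uniformly from the list xs (counted with multiplicity)
record Pr[_∈_]≤_/_ (p : A → Bool) (xs : List A) (N D : ℕ) : Set where
  constructor pr≤
  field count-bound : count p xs * D ≤ N * length xs

open Pr[_∈_]≤_/_ using (count-bound)

count≡0⇒Pr≤ : {p : A → Bool} {xs : List A} → count p xs ≡ 0 → ∀ N D → Pr[ p ∈ xs ]≤ N / D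
count≡0⇒Pr≤ {p = p} {xs} p-null N D = pr≤ (subst (λ c → c * D ≤ N * length xs) (sym p-null) z≤n)

Pr≤-cong : {p q : A → Bool} {xs : List A} {N D : ℕ} → (∀ x → p x ≡ q x) → Pr[ p ∈ xs ]≤ N / D → Pr[ q ∈ xs ]≤ N / D
Pr≤-cong {xs = xs} {N} {D} p≗q (pr≤ h) = pr≤ (subst (λ c → c * D ≤ N * length xs) (count-cong p≗q xs) h)

Pr≤-mono : {p q : A → Bool} {xs : List A} {N D : ℕ} → (∀ x → 𝟙 (p x) ≤ 𝟙 (q x)) → Pr[ q ∈ xs ]≤ N / D → Pr[ p ∈ xs ]≤ N / D
Pr≤-mono {xs = xs} p⇒q (pr≤ h) = pr≤ (≤-trans (*-monoˡ-≤ _ (count-mono p⇒q xs)) h)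

Pr≤-≟-sym : ∀ {n} {f : A → Fin n} {v xs N D} →
  Pr[ (λ x → does (f x ≟ v)) ∈ xs ]≤ N / D → Pr[ (λ x → does (v ≟ f x)) ∈ xs ]≤ N / D
Pr≤-≟-sym {f = f} {v} = Pr≤-cong (λ x → does-⇔ (mk⇔ sym sym) (f x ≟ v) (v ≟ f x))

module _ (f : A → B → C) where

  length-cartesianProductWith : (xs : List A) (ys : List B) →
    length (cartesianProductWith f xs ys) ≡ length xs * length ys
  length-cartesianProductWith []       ys = refl
  length-cartesianProductWith (x ∷ xs) ys = begin-equality
    length (map (f x) ys ++ cartesianProductWith f xs ys)          ≡⟨ length-++ (map (f x) ys) ⟩
    length (map (f x) ys) + length (cartesianProductWith f xs ys)  ≡⟨ cong₂ _+_ (length-map (f x) ys) (length-cartesianProductWith xs ys) ⟩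
    length ys + length xs * length ys                              ∎

  count-cartesianProductWith-fst : {p : C → Bool} {q : A → Bool} → (∀ x y → p (f x y) ≡ q x) →
    (xs : List A) (ys : List B) → count p (cartesianProductWith f xs ys) ≡ count q xs * length ys
  count-cartesianProductWith-fst {p} {q} p≗q []       ys = refl
  count-cartesianProductWith-fst {p} {q} p≗q (x ∷ xs) ys = begin-equality
    count p (map (f x) ys ++ cartesianProductWith f xs ys)           ≡⟨ count-++ p (map (f x) ys) _ ⟩
    count p (map (f x) ys) + count p (cartesianProductWith f xs ys)  ≡⟨ cong₂ _+_ (count-map p (f x) ys) (count-cartesianProductWith-fst p≗q xs ys) ⟩
    count (p ∘ f x) ys + count q xs * length ys                      ≡⟨ cong (_+ count q xs * length ys) (count-cong (p≗q x) ys) ⟩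
    count (λ _ → q x) ys + count q xs * length ys                    ≡⟨ cong (_+ count q xs * length ys) (count-const (q x) ys) ⟩
    𝟙 (q x) * length ys + count q xs * length ys                     ≡⟨ *-distribʳ-+ (length ys) (𝟙 (q x)) _ ⟨
    (𝟙 (q x) + count q xs) * length ys                               ≡⟨ cong (_* length ys) (count-cons q x xs) ⟨
    count q (x ∷ xs) * length ys                                     ∎

  -- Pr ≤ N/D + Pr[b]: the blocks of the x with b x need only the trivial bound
  count-cartesianProductWith-≤ : {p : C → Bool} (b : A → Bool) {N D : ℕ} (xs : List A) (ys : List B) →
    (∀ x → count (p ∘ f x) ys * D ≤ N * length ys + 𝟙 (b x) * (D * length ys)) →
    count p (cartesianProductWith f xs ys) * D ≤ N * (length xs * length ys) + count b xs * (D * length ys)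
  count-cartesianProductWith-≤ {p} b {N} {D} []       ys h = z≤n
  count-cartesianProductWith-≤ {p} b {N} {D} (x ∷ xs) ys h = begin
    count p (map (f x) ys ++ cartesianProductWith f xs ys) * D
      ≡⟨ cong (_* D) (count-++ p (map (f x) ys) _) ⟩
    (count p (map (f x) ys) + count p (cartesianProductWith f xs ys)) * D
      ≡⟨ *-distribʳ-+ D (count p (map (f x) ys)) _ ⟩
    count p (map (f x) ys) * D + count p (cartesianProductWith f xs ys) * D
      ≤⟨ +-mono-≤ (subst (λ c → c * D ≤ _) (sym (count-map p (f x) ys)) (h x)) (count-cartesianProductWith-≤ b {N} xs ys h) ⟩
    (N * length ys + 𝟙 (b x) * M) + (N * (length xs * length ys) + count b xs * M)
      ≡⟨ regroup N (length ys) (𝟙 (b x)) M (length xs) (count b xs) ⟩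
    N * (length ys + length xs * length ys) + (𝟙 (b x) + count b xs) * M
      ≡⟨ cong (λ c → N * (length ys + length xs * length ys) + c * M) (count-cons b x xs) ⟨
    N * (length ys + length xs * length ys) + count b (x ∷ xs) * M ∎
    where
    M : ℕ
    M = D * length ys
    regroup : ∀ N l i M k j → (N * l + i * M) + (N * (k * l) + j * M) ≡ N * (l + k * l) + (i + j) * M
    regroup = solve-∀

  Pr≤-cartesianProductWith : {p : C → Bool} {N D : ℕ} (xs : List A) (ys : List B) →
    (∀ x → Pr[ p ∘ f x ∈ ys ]≤ N / D) → Pr[ p ∈ cartesianProductWith f xs ys ]≤ N / D
  Pr≤-cartesianProductWith {p} {N} {D} xs ys h = pr≤ $ begin
    count p (cartesianProductWith f xs ys) * D
      ≤⟨ count-cartesianProductWith-≤ (λ _ → false) {N} xs ys (λ x → ≤-trans (count-bound (h x)) (m≤m+n _ _)) ⟩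
    N * (length xs * length ys) + count (λ _ → false) xs * (D * length ys)
      ≡⟨ cong (λ c → N * (length xs * length ys) + c * (D * length ys)) (count-const false xs) ⟩
    N * (length xs * length ys) + 0
      ≡⟨ +-identityʳ _ ⟩
    N * (length xs * length ys)
      ≡⟨ cong (N *_) (length-cartesianProductWith xs ys) ⟨
    N * length (cartesianProductWith f xs ys) ∎

  Pr≤-cartesianProductWith-fst : {p : C → Bool} {q : A → Bool} {N D : ℕ} → (∀ x y → p (f x y) ≡ q x) →
    (xs : List A) (ys : List B) → Pr[ q ∈ xs ]≤ N / D → Pr[ p ∈ cartesianProductWith f xs ys ]≤ N / D
  Pr≤-cartesianProductWith-fst {p} {q} {N} {D} p≗q xs ys (pr≤ h) = pr≤ $ begin
    count p (cartesianProductWith f xs ys) * D  ≡⟨ cong (_* D) (count-cartesianProductWith-fst p≗q xs ys) ⟩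
    count q xs * length ys * D                  ≡⟨ swap (count q xs) (length ys) D ⟩
    count q xs * D * length ys                  ≤⟨ *-monoˡ-≤ (length ys) h ⟩
    N * length xs * length ys                   ≡⟨ *-assoc N (length xs) (length ys) ⟩
    N * (length xs * length ys)                 ≡⟨ cong (N *_) (length-cartesianProductWith xs ys) ⟨
    N * length (cartesianProductWith f xs ys)   ∎
    where
    swap : ∀ a b c → a * b * c ≡ a * c * b
    swap = solve-∀

length-allFin : ∀ n → length (allFin n) ≡ n
length-allFin n = length-tabulate id

concatMap-map≡cartesianProductWith : (f : A → B → C) (xs : List A) (ys : List B) →
  concatMap (λ x → map (f x) ys) xs ≡ cartesianProductWith f xs ys
concatMap-map≡cartesianProductWith f []       ys = refl
concatMap-map≡cartesianProductWith f (x ∷ xs) ys = cong (map (f x) ys ++_) (concatMap-map≡cartesianProductWith f xs ys)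

allVecs-suc : (L : List A) (n : ℕ) → allVecs L (suc n) ≡ cartesianProductWith _∷ᵥ_ L (allVecs L n)
allVecs-suc L n = concatMap-map≡cartesianProductWith _∷ᵥ_ L (allVecs L n)

module _ {N D : ℕ} (L : List A) where

  Pr≤-lookup : {q : A → Bool} → Pr[ q ∈ L ]≤ N / D →
    ∀ {n} (i : Fin n) → Pr[ (λ v → q (lookup v i)) ∈ allVecs L n ]≤ N / D
  Pr≤-lookup h {suc n} fzero    rewrite allVecs-suc L n =
    Pr≤-cartesianProductWith-fst _∷ᵥ_ (λ _ _ → refl) L (allVecs L n) h
  Pr≤-lookup h {suc n} (fsuc i) rewrite allVecs-suc L n =
    Pr≤-cartesianProductWith _∷ᵥ_ L (allVecs L n) (λ _ → Pr≤-lookup h i)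

  Pr≤-lookup₂ : {R : A → A → Bool} → (∀ u → Pr[ R u ∈ L ]≤ N / D) → (∀ w → Pr[ (λ u → R u w) ∈ L ]≤ N / D) →
    ∀ {n} {i j : Fin n} → ¬ i ≡ j → Pr[ (λ v → R (lookup v i) (lookup v j)) ∈ allVecs L n ]≤ N / D
  Pr≤-lookup₂ rows cols {suc n} {fzero}  {fzero}  i≢j = contradiction refl i≢j
  Pr≤-lookup₂ rows cols {suc n} {fzero}  {fsuc j} i≢j rewrite allVecs-suc L n =
    Pr≤-cartesianProductWith _∷ᵥ_ L (allVecs L n) (λ u → Pr≤-lookup (rows u) j)
  Pr≤-lookup₂ rows cols {suc n} {fsuc i} {fzero}  i≢j rewrite allVecs-suc L n =
    Pr≤-cartesianProductWith _∷ᵥ_ L (allVecs L n) (λ w → Pr≤-lookup (cols w) i)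
  Pr≤-lookup₂ rows cols {suc n} {fsuc i} {fsuc j} i≢j rewrite allVecs-suc L n =
    Pr≤-cartesianProductWith _∷ᵥ_ L (allVecs L n) (λ _ → Pr≤-lookup₂ rows cols (i≢j ∘ cong fsuc))

∑-const : ∀ n c → ∑[ i < n ] c ≡ n * c
∑-const zero    c = refl
∑-const (suc n) c = cong (c +_) (∑-const n c)

∑-≥-summand : ∀ {n} (f : Fin n → ℕ) i → f i ≤ ∑[ j < n ] f j
∑-≥-summand f fzero    = m≤m+n (f fzero) _
∑-≥-summand f (fsuc i) = ≤-trans (∑-≥-summand (f ∘ fsuc) i) (m≤n+m _ (f fzero))

∑-𝟙-≟ : ∀ {n} (u : Fin n) → ∑[ v < n ] 𝟙 (does (u ≟ v)) ≡ 1
∑-𝟙-≟ {suc n} fzero    = cong suc (trans (∑-const n 0) (*-zeroʳ n))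
∑-𝟙-≟ {suc n} (fsuc u) = ∑-𝟙-≟ u

module _ {n : ℕ} (E : Fin n → A → Bool) where

  ∑-count-[] : ∑[ i < n ] count (E i) [] ≡ 0
  ∑-count-[] = trans (∑-const n 0) (*-zeroʳ n)

  ∑-count-cons : ∀ x xs → ∑[ i < n ] count (E i) (x ∷ xs) ≡ ∑[ i < n ] 𝟙 (E i x) + ∑[ i < n ] count (E i) xs
  ∑-count-cons x xs = trans (sum-cong-≗ (λ i → count-cons (E i) x xs)) (∑-distrib-+ (λ i → 𝟙 (E i x)) _)

  count-≤-∑-count : {p : A → Bool} → (∀ x → 𝟙 (p x) ≤ ∑[ i < n ] 𝟙 (E i x)) →
    ∀ xs → count p xs ≤ ∑[ i < n ] count (E i) xs
  count-≤-∑-count {p} p⇒∃E []       = ≤-reflexive (sym ∑-count-[])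
  count-≤-∑-count {p} p⇒∃E (x ∷ xs) = begin
    count p (x ∷ xs)                                  ≡⟨ count-cons p x xs ⟩
    𝟙 (p x) + count p xs                              ≤⟨ +-mono-≤ (p⇒∃E x) (count-≤-∑-count p⇒∃E xs) ⟩
    ∑[ i < n ] 𝟙 (E i x) + ∑[ i < n ] count (E i) xs  ≡⟨ ∑-count-cons x xs ⟨
    ∑[ i < n ] count (E i) (x ∷ xs)                   ∎

  ∑-count-≤-count : {p : A → Bool} → (∀ x → ∑[ i < n ] 𝟙 (E i x) ≤ 𝟙 (p x)) →
    ∀ xs → ∑[ i < n ] count (E i) xs ≤ count p xs
  ∑-count-≤-count {p} E⇒p []       = ≤-reflexive ∑-count-[]
  ∑-count-≤-count {p} E⇒p (x ∷ xs) = begin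
    ∑[ i < n ] count (E i) (x ∷ xs)                   ≡⟨ ∑-count-cons x xs ⟩
    ∑[ i < n ] 𝟙 (E i x) + ∑[ i < n ] count (E i) xs  ≤⟨ +-mono-≤ (E⇒p x) (∑-count-≤-count E⇒p xs) ⟩
    𝟙 (p x) + count p xs                              ≡⟨ count-cons p x xs ⟨
    count p (x ∷ xs)                                  ∎

count-cartesianProductWith-tabulate : (p : C → Bool) (f : A → B → C) {n : ℕ} (g : Fin n → A) (ys : List B) →
  count p (cartesianProductWith f (tabulate g) ys) ≡ ∑[ i < n ] count (p ∘ f (g i)) ys
count-cartesianProductWith-tabulate p f {zero}  g ys = refl
count-cartesianProductWith-tabulate p f {suc n} g ys = begin-equality
  count p (map (f (g fzero)) ys ++ cartesianProductWith f (tabulate (g ∘ fsuc)) ys)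
    ≡⟨ count-++ p (map (f (g fzero)) ys) _ ⟩
  count p (map (f (g fzero)) ys) + count p (cartesianProductWith f (tabulate (g ∘ fsuc)) ys)
    ≡⟨ cong₂ _+_ (count-map p (f (g fzero)) ys) (count-cartesianProductWith-tabulate p f (g ∘ fsuc) ys) ⟩
  count (p ∘ f (g fzero)) ys + ∑[ i < n ] count (p ∘ f (g (fsuc i))) ys ∎

allVecs-relabel : ∀ {W} (ρ : Permutation W W) {n} (r : Vec (Fin W) n → Bool) →
  count r (allVecs (allFin W) n) ≡ count (r ∘ mapᵥ (ρ ⟨$⟩ʳ_)) (allVecs (allFin W) n)
allVecs-relabel ρ {zero}  r = trans (count-cons r []ᵥ []) (sym (count-cons (r ∘ mapᵥ (ρ ⟨$⟩ʳ_)) []ᵥ []))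
allVecs-relabel {W} ρ {suc n} r = begin-equality
  count r (allVecs (allFin W) (suc n))
    ≡⟨ cong (count r) (allVecs-suc (allFin W) n) ⟩
  count r (cartesianProductWith _∷ᵥ_ (allFin W) V)
    ≡⟨ count-cartesianProductWith-tabulate r _∷ᵥ_ id V ⟩
  ∑[ x < W ] count (λ t → r (x ∷ᵥ t)) V
    ≡⟨ ∑-permute (λ x → count (λ t → r (x ∷ᵥ t)) V) ρ ⟩
  ∑[ x < W ] count (λ t → r ((ρ ⟨$⟩ʳ x) ∷ᵥ t)) V
    ≡⟨ sum-cong-≗ (λ x → allVecs-relabel ρ (λ t → r ((ρ ⟨$⟩ʳ x) ∷ᵥ t))) ⟩
  ∑[ x < W ] count (λ t → r (mapᵥ (ρ ⟨$⟩ʳ_) (x ∷ᵥ t))) V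
    ≡⟨ count-cartesianProductWith-tabulate (r ∘ mapᵥ (ρ ⟨$⟩ʳ_)) _∷ᵥ_ id V ⟨
  count (r ∘ mapᵥ (ρ ⟨$⟩ʳ_)) (cartesianProductWith _∷ᵥ_ (allFin W) V)
    ≡⟨ cong (count (r ∘ mapᵥ (ρ ⟨$⟩ʳ_))) (allVecs-suc (allFin W) n) ⟨
  count (r ∘ mapᵥ (ρ ⟨$⟩ʳ_)) (allVecs (allFin W) (suc n)) ∎
  where
  V : List (Vec (Fin W) n)
  V = allVecs (allFin W) n

count-filterᵇ-cons : (p q : A → Bool) (x : A) (xs : List A) →
  count p (filterᵇ q (x ∷ xs)) ≡ 𝟙 (q x ∧ p x) + count p (filterᵇ q xs)
count-filterᵇ-cons p q x xs with q x
... | false = refl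
... | true  = count-cons p x (filterᵇ q xs)

count-filterᵇ : (p q : A → Bool) (xs : List A) → count p (filterᵇ q xs) ≡ count (λ x → q x ∧ p x) xs
count-filterᵇ p q []       = refl
count-filterᵇ p q (x ∷ xs) = begin-equality
  count p (filterᵇ q (x ∷ xs))                ≡⟨ count-filterᵇ-cons p q x xs ⟩
  𝟙 (q x ∧ p x) + count p (filterᵇ q xs)      ≡⟨ cong (𝟙 (q x ∧ p x) +_) (count-filterᵇ p q xs) ⟩
  𝟙 (q x ∧ p x) + count (λ x → q x ∧ p x) xs  ≡⟨ count-cons (λ x → q x ∧ p x) x xs ⟨
  count (λ x → q x ∧ p x) (x ∷ xs)            ∎

isPerm : ∀ {W} → Vec (Fin W) W → Bool
isPerm v = does (unique? _≟_ (toList v))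

isPerm-relabel : ∀ {W} (ρ : Permutation W W) (v : Vec (Fin W) W) → isPerm (mapᵥ (ρ ⟨$⟩ʳ_) v) ≡ isPerm v
isPerm-relabel ρ v = does-⇔ (mk⇔ unique⁻ unique⁺) (unique? _≟_ (toList (mapᵥ (ρ ⟨$⟩ʳ_) v))) (unique? _≟_ (toList v))
  where
  unique⁻ : Unique (toList (mapᵥ (ρ ⟨$⟩ʳ_) v)) → Unique (toList v)
  unique⁻ u = Unique.map⁻ (subst Unique (toList-map (ρ ⟨$⟩ʳ_) v) u)
  unique⁺ : Unique (toList v) → Unique (toList (mapᵥ (ρ ⟨$⟩ʳ_) v))
  unique⁺ u = subst Unique (sym (toList-map (ρ ⟨$⟩ʳ_) v)) (Unique.map⁺ (Injection.injective (↔⇒↣ ρ)) u)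

allPerms-relabel : ∀ {W} (ρ : Permutation W W) (p : Perm W → Bool) →
  count p (allPerms W) ≡ count (p ∘ mapᵥ (ρ ⟨$⟩ʳ_)) (allPerms W)
allPerms-relabel {W} ρ p = begin-equality
  count p (filterᵇ isPerm V)                                        ≡⟨ count-filterᵇ p isPerm V ⟩
  count (λ v → isPerm v ∧ p v) V                                    ≡⟨ allVecs-relabel ρ (λ v → isPerm v ∧ p v) ⟩
  count (λ v → isPerm (mapᵥ (ρ ⟨$⟩ʳ_) v) ∧ p (mapᵥ (ρ ⟨$⟩ʳ_) v)) V  ≡⟨ count-cong (λ v → cong (_∧ p (mapᵥ (ρ ⟨$⟩ʳ_) v)) (isPerm-relabel ρ v)) V ⟩
  count (λ v → isPerm v ∧ p (mapᵥ (ρ ⟨$⟩ʳ_) v)) V                   ≡⟨ count-filterᵇ (p ∘ mapᵥ (ρ ⟨$⟩ʳ_)) isPerm V ⟨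
  count (p ∘ mapᵥ (ρ ⟨$⟩ʳ_)) (filterᵇ isPerm V)                     ∎
  where
  V : List (Vec (Fin W) W)
  V = allVecs (allFin W) W

transpose-matchˡ : ∀ {n} (i j : Fin n) → transpose i j ⟨$⟩ʳ i ≡ j
transpose-matchˡ i j rewrite dec-true (i ≟ i) refl = refl

⟨$⟩ʳ≡⇔≡⟨$⟩ˡ : ∀ {n} (ρ : Permutation n n) {u v : Fin n} → (ρ ⟨$⟩ʳ u ≡ v) ⇔ (u ≡ ρ ⟨$⟩ˡ v)
⟨$⟩ʳ≡⇔≡⟨$⟩ˡ ρ = mk⇔ (λ ρu≡v → trans (sym (inverseˡ ρ)) (cong (ρ ⟨$⟩ˡ_) ρu≡v))
                     (λ u≡ρ⁻¹v → trans (cong (ρ ⟨$⟩ʳ_) u≡ρ⁻¹v) (inverseʳ ρ))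

count-allPerms-lookup-relabel : ∀ {W} (ρ : Permutation W W) (l v : Fin W) →
  count (λ π → does (lookup π l ≟ v)) (allPerms W) ≡ count (λ π → does (lookup π l ≟ ρ ⟨$⟩ˡ v)) (allPerms W)
count-allPerms-lookup-relabel {W} ρ l v = begin-equality
  count (λ π → does (lookup π l ≟ v)) (allPerms W)
    ≡⟨ allPerms-relabel ρ (λ π → does (lookup π l ≟ v)) ⟩
  count (λ π → does (lookup (mapᵥ (ρ ⟨$⟩ʳ_) π) l ≟ v)) (allPerms W)
    ≡⟨ count-cong (λ π → cong (λ u → does (u ≟ v)) (lookup-map l (ρ ⟨$⟩ʳ_) π)) (allPerms W) ⟩
  count (λ π → does (ρ ⟨$⟩ʳ lookup π l ≟ v)) (allPerms W)
    ≡⟨ count-cong (λ π → does-⇔ (⟨$⟩ʳ≡⇔≡⟨$⟩ˡ ρ) (ρ ⟨$⟩ʳ lookup π l ≟ v) (lookup π l ≟ ρ ⟨$⟩ˡ v)) (allPerms W) ⟩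
  count (λ π → does (lookup π l ≟ ρ ⟨$⟩ˡ v)) (allPerms W) ∎

count-allPerms-lookup-≟ : ∀ {W} (l v v' : Fin W) →
  count (λ π → does (lookup π l ≟ v)) (allPerms W) ≡ count (λ π → does (lookup π l ≟ v')) (allPerms W)
count-allPerms-lookup-≟ {W} l v v' =
  subst (λ u → count (λ π → does (lookup π l ≟ v)) (allPerms W) ≡ count (λ π → does (lookup π l ≟ u)) (allPerms W))
        (transpose-matchˡ v v') (count-allPerms-lookup-relabel (transpose v' v) l v)

-- each of the W values is taken by π l for the same number of permutations π
Pr≤-allPerms-lookup : ∀ {W} (l v : Fin W) → Pr[ (λ π → does (lookup π l ≟ v)) ∈ allPerms W ]≤ 1 / W
Pr≤-allPerms-lookup {W} l v = pr≤ $ begin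
  count (E v) (allPerms W) * W           ≡⟨ *-comm (count (E v) (allPerms W)) W ⟩
  W * count (E v) (allPerms W)           ≡⟨ ∑-const W (count (E v) (allPerms W)) ⟨
  ∑[ v' < W ] count (E v) (allPerms W)   ≡⟨ sum-cong-≗ (count-allPerms-lookup-≟ l v) ⟩
  ∑[ v' < W ] count (E v') (allPerms W)  ≤⟨ ∑-count-≤-count E (λ π → ≤-reflexive (∑-𝟙-≟ (lookup π l))) (allPerms W) ⟩
  count (λ _ → true) (allPerms W)        ≡⟨ count-const true (allPerms W) ⟩
  1 * length (allPerms W)                ∎
  where
  E : Fin W → Perm W → Bool
  E v π = does (lookup π l ≟ v)

All-toList-lookup : ∀ {P : A → Set} {n} (v : Vec A n) → All P (toList v) → ∀ i → P (lookup v i)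
All-toList-lookup (x ∷ᵥ v) (px ∷ _)   fzero    = px
All-toList-lookup (x ∷ᵥ v) (_  ∷ pxs) (fsuc i) = All-toList-lookup v pxs i

Unique-toList-lookup-injective : ∀ {n} (v : Vec A n) → Unique (toList v) → ∀ {i j} → lookup v i ≡ lookup v j → i ≡ j
Unique-toList-lookup-injective (x ∷ᵥ v) (x∉ ∷ u) {fzero}  {fzero}  eq = refl
Unique-toList-lookup-injective (x ∷ᵥ v) (x∉ ∷ u) {fzero}  {fsuc j} eq = contradiction eq (All-toList-lookup v x∉ j)
Unique-toList-lookup-injective (x ∷ᵥ v) (x∉ ∷ u) {fsuc i} {fzero}  eq = contradiction (sym eq) (All-toList-lookup v x∉ i)
Unique-toList-lookup-injective (x ∷ᵥ v) (x∉ ∷ u) {fsuc i} {fsuc j} eq = cong fsuc (Unique-toList-lookup-injective v u eq)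

count-allPerms-lookup-collision : ∀ {W} {l l' : Fin W} → ¬ l ≡ l' →
  count (λ π → does (lookup π l ≟ lookup π l')) (allPerms W) ≡ 0
count-allPerms-lookup-collision {W} {l} {l'} l≢l' =
  trans (count-filterᵇ _ isPerm (allVecs (allFin W) W))
        (trans (count-cong no-collision (allVecs (allFin W) W)) (count-const false (allVecs (allFin W) W)))
  where
  no-collision : ∀ π → (isPerm π ∧ does (lookup π l ≟ lookup π l')) ≡ false
  no-collision π with unique? _≟_ (toList π)
  ... | no _  = refl
  ... | yes u = dec-false (lookup π l ≟ lookup π l') (l≢l' ∘ Unique-toList-lookup-injective π u)

allArray : (W : ℕ) → List (Array W)
allArray W = allVecs (allPerms W) (W ^ 3)

Pr≤-arrayAt : ∀ {W} (m : Fin (W ^ 3)) (l v : Fin W) → Pr[ (λ a → does (arrayAt a m l ≟ v)) ∈ allArray W ]≤ 1 / W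
Pr≤-arrayAt {W} m l v = Pr≤-lookup (allPerms W) (Pr≤-allPerms-lookup l v) m

Pr≤-arrayAt-collision : ∀ {W} {m m' : Fin (W ^ 3)} {l l' : Fin W} → ¬ (m , l) ≡ (m' , l') →
  Pr[ (λ a → does (arrayAt a m l ≟ arrayAt a m' l')) ∈ allArray W ]≤ 1 / W
Pr≤-arrayAt-collision {W} {m} {m'} {l} {l'} ml≢m'l' with m ≟ m'
... | no m≢m'  = Pr≤-lookup₂ (allPerms W)
                   (λ π → Pr≤-≟-sym {f = λ σ → lookup σ l'} (Pr≤-allPerms-lookup l' (lookup π l)))
                   (λ σ → Pr≤-allPerms-lookup l (lookup σ l')) m≢m'
... | yes refl = Pr≤-lookup (allPerms W)
                   (count≡0⇒Pr≤ (count-allPerms-lookup-collision (ml≢m'l' ∘ cong (m ,_))) 1 W) m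

Position : ℕ → ℕ → Set
Position W P = Fin P × Fin (W ^ 3) × Fin W

_≟ₚ_ : ∀ {W P} → DecidableEquality (Position W P)
_≟ₚ_ = ≡-dec _≟_ (≡-dec _≟_ _≟_)

entry : ∀ {W P} → Arrays W P → Position W P → Fin W
entry A (p , m , l) = arrayAt (lookup A p) m l

Pr≤-entry-collision : ∀ {W P} {s s' : Position W P} → ¬ s ≡ s' →
  Pr[ (λ A → does (entry A s ≟ entry A s')) ∈ allArrays W P ]≤ 1 / W
Pr≤-entry-collision {W} {P} {p , m , l} {p' , m' , l'} s≢s' with p ≟ p'
... | no p≢p'  = Pr≤-lookup₂ (allArray W)
                   (λ a → Pr≤-≟-sym {f = λ b → arrayAt b m' l'} (Pr≤-arrayAt m' l' (arrayAt a m l)))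
                   (λ b → Pr≤-arrayAt m l (arrayAt b m' l')) p≢p'
... | yes refl = Pr≤-lookup (allArray W) (Pr≤-arrayAt-collision (s≢s' ∘ cong (p ,_))) p

𝟙-≟-≤-∑ : ∀ {n} (u w : Fin n) → 𝟙 (does (u ≟ w)) ≤ ∑[ i < n ] 𝟙 (does (u ≟ i) ∧ does (w ≟ i))
𝟙-≟-≤-∑ u w with u ≟ w
... | no _     = z≤n
... | yes refl = subst (_≤ ∑[ i < _ ] 𝟙 (does (u ≟ i) ∧ does (u ≟ i)))
                   (cong (λ b → 𝟙 (b ∧ b)) (dec-true (u ≟ u) refl))
                   (∑-≥-summand (λ i → 𝟙 (does (u ≟ i) ∧ does (u ≟ i))) u)

*-cancel-square : ∀ c {W P K} → W ≤ P → c * (P * P) ≤ P * K → c * W ≤ K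
*-cancel-square c {W} {zero}  {K} W≤0 _ rewrite n≤0⇒n≡0 W≤0 | *-zeroʳ c = z≤n
*-cancel-square c {W} {suc P} {K} W≤P cP²≤PK = ≤-trans (*-monoʳ-≤ c W≤P) (*-cancelʳ-≤ (c * suc P) K (suc P) cP·P≤K·P)
  where
  cP·P≤K·P : c * suc P * suc P ≤ K * suc P
  cP·P≤K·P = begin
    c * suc P * suc P    ≡⟨ *-assoc c (suc P) (suc P) ⟩
    c * (suc P * suc P)  ≤⟨ cP²≤PK ⟩
    suc P * K            ≡⟨ *-comm (suc P) K ⟩
    K * suc P            ∎

-- Pr_k[F k a = F k b] = Σ_i Pr_k[F k a = i ∧ F k b = i] = P ⋅ 1/P² ≤ 1/W
Pr≤-pairwiseIndependent-collision : ∀ {K M P} (F : Fin K → Fin M → Fin P) → PairwiseIndependent F →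
  ∀ {a b} → ¬ a ≡ b → ∀ {W} → W ≤ P → Pr[ (λ k → does (F k a ≟ F k b)) ∈ allFin K ]≤ 1 / W
Pr≤-pairwiseIndependent-collision {K} {M} {P} F indep {a} {b} a≢b {W} W≤P = pr≤ $ begin
  count collide (allFin K) * W  ≤⟨ *-cancel-square (count collide (allFin K)) W≤P collide·P²≤P·K ⟩
  K                             ≡⟨ length-allFin K ⟨
  length (allFin K)             ≡⟨ *-identityˡ (length (allFin K)) ⟨
  1 * length (allFin K)         ∎
  where
  collide : Fin K → Bool
  collide k = does (F k a ≟ F k b)
  E : Fin P → Fin K → Bool
  E i k = does (F k a ≟ i) ∧ does (F k b ≟ i)
  collide·P²≤P·K : count collide (allFin K) * (P * P) ≤ P * K
  collide·P²≤P·K = begin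
    count collide (allFin K) * (P * P)             ≤⟨ *-monoˡ-≤ (P * P) (count-≤-∑-count E (λ k → 𝟙-≟-≤-∑ (F k a) (F k b)) (allFin K)) ⟩
    (∑[ i < P ] count (E i) (allFin K)) * (P * P)  ≡⟨ *-distribʳ-sum (P * P) (λ i → count (E i) (allFin K)) ⟩
    ∑[ i < P ] (count (E i) (allFin K) * (P * P))  ≡⟨ sum-cong-≗ (λ i → indep a b a≢b i i) ⟩
    ∑[ i < P ] K                                   ≡⟨ ∑-const P K ⟩
    P * K                                          ∎

count-entry-collision-≤ : ∀ {W P} (s s' : Position W P) →
  count (λ A → does (entry A s ≟ entry A s')) (allArrays W P) * W
    ≤ 1 * length (allArrays W P) + 𝟙 (does (s ≟ₚ s')) * (W * length (allArrays W P))
count-entry-collision-≤ {W} {P} s s' with s ≟ₚ s'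
... | no s≢s' = ≤-trans (count-bound (Pr≤-entry-collision s≢s')) (m≤m+n _ _)
... | yes _   = begin
  count (λ A → does (entry A s ≟ entry A s')) (allArrays W P) * W  ≤⟨ *-monoˡ-≤ W (count-≤-length _ (allArrays W P)) ⟩
  length (allArrays W P) * W                                       ≡⟨ *-comm (length (allArrays W P)) W ⟩
  W * length (allArrays W P)                                       ≡⟨ *-identityˡ (W * length (allArrays W P)) ⟨
  1 * (W * length (allArrays W P))                                 ≤⟨ m≤n+m _ (1 * length (allArrays W P)) ⟩
  1 * length (allArrays W P) + 1 * (W * length (allArrays W P))    ∎

slot : ∀ {M W P} → (Fin M → Fin P) → Key M W → Position W P
slot {M} {W} f x = f (high {M} {W} x) , mid {M} {W} x , low {M} {W} x

high-mid-low-injective : ∀ {M W} {x y : Key M W} → high {M} {W} x ≡ high {M} {W} y →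
  mid {M} {W} x ≡ mid {M} {W} y → low {M} {W} x ≡ low {M} {W} y → x ≡ y
high-mid-low-injective {M} {W} {x} {y} high≡ mid≡ low≡ =
  trans (sym (combine-remQuot {M} (W ^ 3 * W) x))
        (trans (cong₂ combine high≡ midlow≡) (combine-remQuot {M} (W ^ 3 * W) y))
  where
  midlow≡ : midlow {M} {W} x ≡ midlow {M} {W} y
  midlow≡ = trans (sym (combine-remQuot {W ^ 3} W (midlow {M} {W} x)))
                  (trans (cong₂ combine mid≡ low≡) (combine-remQuot {W ^ 3} W (midlow {M} {W} y)))

Pr≤-slot-collision : ∀ {K M W P} (F : Fin K → Fin M → Fin P) → PairwiseIndependent F → W ≤ P →
  {x y : Key M W} → ¬ x ≡ y → Pr[ (λ k → does (slot (F k) x ≟ₚ slot (F k) y)) ∈ allFin K ]≤ 1 / W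
Pr≤-slot-collision {K} {M} {W} {P} F indep W≤P {x} {y} x≢y with high {M} {W} x ≟ high {M} {W} y
... | no high≢  = Pr≤-mono (λ k → 𝟙-does-mono (cong proj₁) (slot (F k) x ≟ₚ slot (F k) y) (F k _ ≟ F k _))
                           (Pr≤-pairwiseIndependent-collision F indep high≢ W≤P)
... | yes high≡ = count≡0⇒Pr≤ (trans (count-cong never (allFin K)) (count-const false (allFin K))) 1 W
  where
  never : ∀ k → does (slot (F k) x ≟ₚ slot (F k) y) ≡ false
  never k = dec-false (slot (F k) x ≟ₚ slot (F k) y)
    (λ eq → x≢y (high-mid-low-injective {M} {W} high≡ (cong (proj₁ ∘ proj₂) eq) (cong (proj₂ ∘ proj₂) eq)))

Pr≤-hash-collision : ∀ {K M W P} (F : Fin K → Fin M → Fin P) → PairwiseIndependent F → W ≤ P →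
  {x y : Key M W} → ¬ x ≡ y →
  Pr[ (λ ω → does (hashH (F (proj₁ ω)) (proj₂ ω) x ≟ hashH (F (proj₁ ω)) (proj₂ ω) y))
      ∈ cartesianProduct (allFin K) (allArrays W P) ]≤ 2 / W
Pr≤-hash-collision {K} {M} {W} {P} F indep W≤P {x} {y} x≢y = pr≤ $ begin
  count collide (cartesianProduct (allFin K) (allArrays W P)) * W
    ≤⟨ count-cartesianProductWith-≤ _,_ slotCollide {1} (allFin K) (allArrays W P)
         (λ k → count-entry-collision-≤ (slot (F k) x) (slot (F k) y)) ⟩
  1 * (Lk * La) + count slotCollide (allFin K) * (W * La)
    ≡⟨ cong (1 * (Lk * La) +_) (*-assoc (count slotCollide (allFin K)) W La) ⟨
  1 * (Lk * La) + count slotCollide (allFin K) * W * La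
    ≤⟨ +-monoʳ-≤ (1 * (Lk * La)) (*-monoˡ-≤ La (count-bound (Pr≤-slot-collision F indep W≤P x≢y))) ⟩
  1 * (Lk * La) + 1 * Lk * La
    ≡⟨ double Lk La ⟩
  2 * (Lk * La)
    ≡⟨ cong (2 *_) (length-cartesianProductWith _,_ (allFin K) (allArrays W P)) ⟨
  2 * length (cartesianProduct (allFin K) (allArrays W P)) ∎
  where
  collide : Fin K × Arrays W P → Bool
  collide (k , A) = does (hashH (F k) A x ≟ hashH (F k) A y)
  slotCollide : Fin K → Bool
  slotCollide k = does (slot (F k) x ≟ₚ slot (F k) y)
  Lk La : ℕ
  Lk = length (allFin K)
  La = length (allArrays W P)
  double : ∀ a b → 1 * (a * b) + 1 * a * b ≡ 2 * (a * b)
  double = solve-∀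

count-any-≤ : {Q : Set} (E : Q → A → Bool) (qs : List Q) (xs : List A) {D B : ℕ} →
  (∀ q → count (E q) xs * D ≤ B) → count (λ x → any (λ q → E q x) qs) xs * D ≤ length qs * B
count-any-≤ E []       xs {D} h = ≤-reflexive (cong (_* D) (count-const false xs))
count-any-≤ E (q ∷ qs) xs {D} {B} h = begin
  count (λ x → E q x ∨ any (λ q → E q x) qs) xs * D
    ≤⟨ *-monoˡ-≤ D (count-∨ (E q) (λ x → any (λ q → E q x) qs) xs) ⟩
  (count (E q) xs + count (λ x → any (λ q → E q x) qs) xs) * D
    ≡⟨ *-distribʳ-+ D (count (E q) xs) _ ⟩
  count (E q) xs * D + count (λ x → any (λ q → E q x) qs) xs * D
    ≤⟨ +-mono-≤ (h q) (count-any-≤ E qs xs h) ⟩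
  B + length qs * B ∎

count-distinct-hash-collision-≤ : ∀ {K M W P n} (F : Fin K → Fin M → Fin P) → PairwiseIndependent F → W ≤ P →
  (xs : Fin n → Key M W) → Injective _≡_ _≡_ xs → (i j : Fin n) →
  count (λ ω → not (does (i ≟ j)) ∧ does (hashH (F (proj₁ ω)) (proj₂ ω) (xs i) ≟ hashH (F (proj₁ ω)) (proj₂ ω) (xs j)))
        (cartesianProduct (allFin K) (allArrays W P)) * W
    ≤ 2 * length (cartesianProduct (allFin K) (allArrays W P))
count-distinct-hash-collision-≤ {K} {M} {W} {P} F indep W≤P xs xs-injective i j with i ≟ j
... | yes _   = count-bound (count≡0⇒Pr≤ {p = λ _ → false} {xs = Ω} (count-const false Ω) 2 W)
  where
  Ω : List (Fin K × Arrays W P)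
  Ω = cartesianProduct (allFin K) (allArrays W P)
... | no i≢j = count-bound (Pr≤-hash-collision F indep W≤P (i≢j ∘ xs-injective))

*-^-≤ : ∀ {B T m} c → m ≤ 1 → B ≤ T → B * m ^ c ≤ T
*-^-≤ {B} {T} {m} c m≤1 B≤T = begin
  B * m ^ c  ≤⟨ *-monoʳ-≤ B (^-monoˡ-≤ c m≤1) ⟩
  B * 1 ^ c  ≡⟨ cong (B *_) (^-zeroˡ c) ⟩
  B * 1      ≡⟨ *-identityʳ B ⟩
  B          ≤⟨ B≤T ⟩
  T          ∎

-- from  B ⋅ W ≤ 2 n² T  and  m³ ⋅ mᶜ ≤ W  with n ≤ m ≥ 2, the factor m³ ≥ 2 m² absorbs 2 n²
union-bound⇒≤ : ∀ {B T W n m} c → B ≤ T → B * W ≤ n * n * (2 * T) → n ≤ m → m ^ (3 + c) ≤ W → B * m ^ c ≤ T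
union-bound⇒≤ {m = zero}          c B≤T _ _ _ = *-^-≤ c z≤n B≤T
union-bound⇒≤ {m = suc zero}      c B≤T _ _ _ = *-^-≤ c ≤-refl B≤T
union-bound⇒≤ {B} {T} {W} {n} {m = suc (suc k)} c B≤T BW≤2n²T n≤m m³⁺ᶜ≤W =
  *-cancelˡ-≤ 2 (≤-trans (*-monoˡ-≤ X (s≤s (s≤s (z≤n {k})))) mX≤2T)
  where
  m X : ℕ
  m = suc (suc k)
  X = B * m ^ c
  mX≤2T : m * X ≤ 2 * T
  mX≤2T = *-cancelˡ-≤ (m * m) (begin
    (m * m) * (m * X)  ≡⟨ regroup B m (m ^ c) ⟩
    B * m ^ (3 + c)    ≤⟨ *-monoʳ-≤ B m³⁺ᶜ≤W ⟩
    B * W              ≤⟨ BW≤2n²T ⟩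
    n * n * (2 * T)    ≤⟨ *-monoˡ-≤ (2 * T) (*-mono-≤ n≤m n≤m) ⟩
    (m * m) * (2 * T)  ∎)
    where
    regroup : ∀ B m p → (m * m) * (m * (B * p)) ≡ B * (m * (m * (m * p)))
    regroup = solve-∀

length-outcomes : ∀ K W P → length (cartesianProduct (allFin K) (allArrays W P)) ≡ totalCount K W P
length-outcomes K W P =
  trans (length-cartesianProductWith _,_ (allFin K) (allArrays W P)) (cong (_* length (allArrays W P)) (length-allFin K))

badCount-≤-totalCount : ∀ {K M W P n} (F : Fin K → Fin M → Fin P) (xs : Fin n → Key M W) →
  badCount W F xs ≤ totalCount K W P
badCount-≤-totalCount {K} {M} {W} {P} F xs =
  subst (badCount W F xs ≤_) (length-outcomes K W P) (count-≤-length _ (cartesianProduct (allFin K) (allArrays W P)))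

badCount-union-bound : ∀ {K M W P n} (F : Fin K → Fin M → Fin P) → PairwiseIndependent F → W ≤ P →
  (xs : Fin n → Key M W) → Injective _≡_ _≡_ xs → badCount W F xs * W ≤ n * n * (2 * totalCount K W P)
badCount-union-bound {K} {M} {W} {P} {n} F indep W≤P xs xs-injective = begin
  badCount W F xs * W             ≤⟨ count-any-≤ collision pairs Ω (λ (i , j) → count-distinct-hash-collision-≤ F indep W≤P xs xs-injective i j) ⟩
  length pairs * (2 * length Ω)   ≡⟨ cong₂ (λ a b → a * (2 * b)) length-pairs (length-outcomes K W P) ⟩
  n * n * (2 * totalCount K W P)  ∎
  where
  Ω : List (Fin K × Arrays W P)
  Ω = cartesianProduct (allFin K) (allArrays W P)
  pairs : List (Fin n × Fin n)
  pairs = cartesianProduct (allFin n) (allFin n)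
  collision : Fin n × Fin n → Fin K × Arrays W P → Bool
  collision (i , j) (k , A) = not (does (i ≟ j)) ∧ does (hashH (F k) A (xs i) ≟ hashH (F k) A (xs j))
  length-pairs : length pairs ≡ n * n
  length-pairs = trans (length-cartesianProductWith _,_ (allFin n) (allFin n)) (cong₂ _*_ (length-allFin n) (length-allFin n))

lemma3 : (c : ℕ) → ∃ λ (d : ℕ) →
    (nmax W P M K : ℕ) → PowerOfTwo W → nmax ^ d ≤ W → W ≤ P →
    (F : Fin K → Fin M → Fin P) → PairwiseIndependent F →
    (n : ℕ) → n ≤ nmax →
    (xs : Fin n → Key M W) → Injective _≡_ _≡_ xs →
    badCount W F xs * nmax ^ c ≤ totalCount K W P
lemma3 c = 3 + c , λ nmax W P M K _ nmax³⁺ᶜ≤W W≤P F indep n n≤nmax xs xs-injective →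
  union-bound⇒≤ c (badCount-≤-totalCount F xs) (badCount-union-bound F indep W≤P xs xs-injective) n≤nmax nmax³⁺ᶜ≤W
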